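{- Let $X$ be a finite set with a partition $\pi$. Then $$\max_{\alpha\in S_X}|D(X,\pi,\alpha)|=|X|-|\widehat{\pi}_r|,$$ where $r$ is such that $|\widehat{\pi}_r|\ge|\widehat{\pi}_k|$ for all $k\in\mathbb{N}$.
   Context: For $k\in\mathbb{N}_{\ge1}$, the $k$-zone $\widehat{\pi}_k\subseteq X$ is the union of all blocks of $\pi$ of cardinality $k$ (empty if there are none). For $i\in X$, $S(i)=\ln$ of the size of the block containing $i$; $D(X,\pi,\alpha)=\{i\in X:S(\alpha(i))<S(i)\}$. -}

module Defs where

open import Data.Nat using (ℕ; _<_; _<?_; _≟_)
open import Data.Fin using (Fin)
open import Data.List using (List; length; filter)
open import Data.Fin.Permutation using (Permutation′; _⟨$⟩ʳ_)
open import Data.List using () renaming (allFin to allFinL)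

-- A partition π of X = Fin n is given by a block-labelling: i and j lie in the
-- same block of π iff (π i ≡ π j).  Every partition of Fin n arises this way.
Partition : ℕ → Set
Partition n = Fin n → ℕ

elems : (n : ℕ) → List (Fin n)
elems n = allFinL n

blockSize : ∀ {n} → Partition n → Fin n → ℕ
blockSize {n} π i = length (filter (λ j → π j ≟ π i) (elems n))

zoneSize : ∀ {n} → Partition n → ℕ → ℕ
zoneSize {n} π k = length (filter (λ i → blockSize π i ≟ k) (elems n))

-- |D(X,π,α)| : number of i with S(α i) < S(i), i.e. (ln monotone)
-- blockSize (α i) < blockSize i
descentCount : ∀ {n} → Partition n → Permutation′ n → ℕ
descentCount {n} π α =
  length (filter (λ i → blockSize π (α ⟨$⟩ʳ i) <? blockSize π i) (elems n))

module Submission where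

-- Write f i for the size of the block containing i (ln is monotone, so
-- S(α i) < S(i) iff f (α i) < f i) and level v for the number of i with
-- f i = v, i.e. the size of the v-zone.  Everything is proved for an
-- arbitrary "height" function f : Fin n → ℕ.
--
-- A descent at i has f (α i) < r or r < f i.  Since α is a
-- bijection, the first kind occurs exactly #{f < r} times, so every α has
-- at most #{f < r} + #{r < f} = n ∸ level r descents, for every r.
--
-- Sort X by the key (f i , i); the rank of i in this order
-- lies in [below (f i) , below (f i) + level (f i)).  If no level exceeds
-- m, an element whose rank is at least m is strictly higher than the
-- element m positions before it.  Conjugating the rotation p ↦ p − m
-- (mod n) of ranks by the ranking permutation therefore gives a
-- permutation with at least n ∸ m descents; for m the maximal level this
-- meets the upper bound.

open import Defs
open import Data.Nat using (ℕ; zero; suc; _+_; _∸_; _≤_; _<_; _≤?_; _<?_; _≟_; z≤n; s≤s; s≤s⁻¹)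
open import Data.Nat.Properties
open import Data.Fin using (Fin; zero; suc; toℕ; cast; splitAt; _↑ˡ_; _↑ʳ_; punchOut; fromℕ<)
open import Data.Fin.Properties
  using (any?; punchOut-injective; injective⇒≤; +↔⊎; toℕ<n; toℕ-cast; toℕ-↑ˡ; toℕ-↑ʳ;
         splitAt⁻¹-↑ˡ; splitAt⁻¹-↑ʳ; toℕ-fromℕ<)
  renaming (_≟_ to _≟ᶠ_; <-strictTotalOrder to <ᶠ-strictTotalOrder)
open import Data.Fin.Permutation
  using (Permutation′; _⟨$⟩ʳ_; permutation; cast-id; _∘ₚ_; flip; inverseʳ)
open import Data.List using (length; filter; tabulate)
open import Data.Product using (Σ; ∃; _×_; _,_; proj₁; proj₂)
open import Data.Product.Relation.Binary.Lex.Strict using (×-strictTotalOrder)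
open import Data.Sum using (_⊎_; inj₁; inj₂; [_,_])
open import Data.Sum.Algebra using (⊎-comm)
open import Data.Empty using (⊥; ⊥-elim)
open import Data.Unit using (tt)
open import Level using (Level; 0ℓ)
open import Function using (_∘_)
open import Function.Definitions using (Injective)
open import Function.Properties.Inverse using (↔-trans; ↔-sym)
open import Relation.Binary using (StrictTotalOrder; tri<; tri≈; tri>)
open import Relation.Binary.PropositionalEquality
  using (_≡_; _≢_; refl; sym; trans; cong; cong₂; subst₂; module ≡-Reasoning)
open import Relation.Nullary using (Dec; yes; no; ¬_; contradiction)
open import Relation.Unary using (Pred; Decidable)
open import Algebra.Properties.CommutativeMonoid.Sum +-0-commutativeMonoid
  using (sum; sum-permute; ∑-distrib-+)

indicator : ∀ {P : Set} → Dec P → ℕ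
indicator (yes _) = 1
indicator (no _)  = 0

indicator-yes : ∀ {P : Set} (d : Dec P) → P → indicator d ≡ 1
indicator-yes (yes _) _ = refl
indicator-yes (no ¬p) p = ⊥-elim (¬p p)

indicator-no : ∀ {P : Set} (d : Dec P) → ¬ P → indicator d ≡ 0
indicator-no (yes p) ¬p = ⊥-elim (¬p p)
indicator-no (no _)  _  = refl

indicator-mono : ∀ {P Q : Set} → (P → Q) → (d : Dec P) (e : Dec Q) → indicator d ≤ indicator e
indicator-mono P⇒Q (yes p) e = ≤-reflexive (sym (indicator-yes e (P⇒Q p)))
indicator-mono P⇒Q (no _)  e = z≤n

indicator-union : ∀ {P Q R : Set} → (P → Q ⊎ R) →
  (d : Dec P) (e : Dec Q) (g : Dec R) → indicator d ≤ indicator e + indicator g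
indicator-union cover (no _)  e g = z≤n
indicator-union cover (yes p) e g with cover p
... | inj₁ q = ≤-trans (indicator-mono (λ _ → q) (yes p) e) (m≤m+n _ _)
... | inj₂ r = ≤-trans (indicator-mono (λ _ → r) (yes p) g) (m≤n+m _ _)

indicator-disjoint : ∀ {P Q R : Set} → (P → Q → ⊥) → (P ⊎ Q → R) →
  (d : Dec P) (e : Dec Q) (g : Dec R) → indicator d + indicator e ≤ indicator g
indicator-disjoint disj into (yes p) (yes q) g = ⊥-elim (disj p q)
indicator-disjoint disj into (yes p) (no _)  g = indicator-mono (λ _ → into (inj₁ p)) (yes p) g
indicator-disjoint disj into (no _)  e       g = indicator-mono (λ q → into (inj₂ q)) e g

sum-mono : ∀ {n} (g h : Fin n → ℕ) → (∀ i → g i ≤ h i) → sum g ≤ sum h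
sum-mono {zero}  g h g≤h = z≤n
sum-mono {suc n} g h g≤h =
  +-mono-≤ (g≤h zero) (sum-mono (λ i → g (suc i)) (λ i → h (suc i)) (λ i → g≤h (suc i)))

sum-strict : ∀ {n} (g h : Fin n → ℕ) → (∀ i → g i ≤ h i) → (j : Fin n) → g j < h j → sum g < sum h
sum-strict {suc n} g h g≤h zero    gj<hj =
  +-mono-<-≤ gj<hj (sum-mono (λ i → g (suc i)) (λ i → h (suc i)) (λ i → g≤h (suc i)))
sum-strict {suc n} g h g≤h (suc j) gj<hj =
  +-mono-≤-< (g≤h zero) (sum-strict (λ i → g (suc i)) (λ i → h (suc i)) (λ i → g≤h (suc i)) j gj<hj)

count : ∀ {n} {P : Pred (Fin n) 0ℓ} → Decidable P → ℕ
count P? = sum (λ i → indicator (P? i))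

count-filter : ∀ {n} {A : Set} {P : Pred A 0ℓ} (P? : Decidable P) (g : Fin n → A) →
  length (filter P? (tabulate g)) ≡ count (λ i → P? (g i))
count-filter {zero}  P? g = refl
count-filter {suc n} P? g with P? (g zero)
... | yes _ = cong suc (count-filter P? (λ i → g (suc i)))
... | no _  = count-filter P? (λ i → g (suc i))

count-mono : ∀ {n} {P Q : Pred (Fin n) 0ℓ} (P? : Decidable P) (Q? : Decidable Q) →
  (∀ i → P i → Q i) → count P? ≤ count Q?
count-mono P? Q? P⊆Q = sum-mono _ _ (λ i → indicator-mono (P⊆Q i) (P? i) (Q? i))

count-strict : ∀ {n} {P Q : Pred (Fin n) 0ℓ} (P? : Decidable P) (Q? : Decidable Q) →
  (∀ i → P i → Q i) → (j : Fin n) → Q j → ¬ P j → count P? < count Q?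
count-strict P? Q? P⊆Q j Qj ¬Pj = sum-strict _ _ (λ i → indicator-mono (P⊆Q i) (P? i) (Q? i)) j
  (subst₂ _<_ (sym (indicator-no (P? j) ¬Pj)) (sym (indicator-yes (Q? j) Qj)) (s≤s z≤n))

count-cong : ∀ {n} {P Q : Pred (Fin n) 0ℓ} (P? : Decidable P) (Q? : Decidable Q) →
  (∀ i → P i → Q i) → (∀ i → Q i → P i) → count P? ≡ count Q?
count-cong P? Q? P⊆Q Q⊆P = ≤-antisym (count-mono P? Q? P⊆Q) (count-mono Q? P? Q⊆P)

count-union : ∀ {n} {P Q R : Pred (Fin n) 0ℓ}
  (P? : Decidable P) (Q? : Decidable Q) (R? : Decidable R) →
  (∀ i → P i → Q i ⊎ R i) → count P? ≤ count Q? + count R?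
count-union P? Q? R? cover = begin
  count P?                        ≤⟨ sum-mono _ _ (λ i → indicator-union (cover i) (P? i) (Q? i) (R? i)) ⟩
  sum (λ i → 𝟙Q i + 𝟙R i)         ≡⟨ ∑-distrib-+ 𝟙Q 𝟙R ⟩
  count Q? + count R?             ∎
  where
  open ≤-Reasoning
  𝟙Q 𝟙R : Fin _ → ℕ
  𝟙Q i = indicator (Q? i)
  𝟙R i = indicator (R? i)

count-disjoint : ∀ {n} {P Q R : Pred (Fin n) 0ℓ}
  (P? : Decidable P) (Q? : Decidable Q) (R? : Decidable R) →
  (∀ i → P i → Q i → ⊥) → (∀ i → P i ⊎ Q i → R i) → count P? + count Q? ≤ count R?
count-disjoint P? Q? R? disj into = begin
  count P? + count Q?             ≡⟨ ∑-distrib-+ 𝟙P 𝟙Q ⟨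
  sum (λ i → 𝟙P i + 𝟙Q i)         ≤⟨ sum-mono _ _ pointwise ⟩
  count R?                        ∎
  where
  open ≤-Reasoning
  𝟙P 𝟙Q : Fin _ → ℕ
  𝟙P i = indicator (P? i)
  𝟙Q i = indicator (Q? i)
  pointwise : ∀ i → 𝟙P i + 𝟙Q i ≤ indicator (R? i)
  pointwise i = indicator-disjoint (disj i) (into i) (P? i) (Q? i) (R? i)

count-permute : ∀ {n} {P : Pred (Fin n) 0ℓ} (P? : Decidable P) (σ : Permutation′ n) →
  count (λ i → P? (σ ⟨$⟩ʳ i)) ≡ count P?
count-permute P? σ = sym (sum-permute _ σ)

count-all : ∀ {n} {P : Pred (Fin n) 0ℓ} (P? : Decidable P) → (∀ i → P i) → count P? ≡ n
count-all {zero}  P? all = refl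
count-all {suc n} P? all =
  cong₂ _+_ (indicator-yes (P? zero) (all zero)) (count-all (λ i → P? (suc i)) (λ i → all (suc i)))

count-≤ : ∀ {n} {P : Pred (Fin n) 0ℓ} (P? : Decidable P) → count P? ≤ n
count-≤ {n} P? = begin
  count P?                         ≤⟨ count-mono P? (λ _ → yes tt) (λ _ _ → tt) ⟩
  count {n} (λ (_ : Fin n) → yes tt) ≡⟨ count-all (λ _ → yes tt) (λ _ → tt) ⟩
  n                                ∎
  where open ≤-Reasoning

count-≥ : ∀ n m → count {n} (λ p → m ≤? toℕ p) ≡ n ∸ m
count-≥ zero    m       = sym (0∸n≡0 m)
count-≥ (suc n) zero    = count-all (λ p → 0 ≤? toℕ p) (λ _ → z≤n)
count-≥ (suc n) (suc m) = begin
  indicator (suc m ≤? 0) + count {n} (λ p → suc m ≤? suc (toℕ p))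
    ≡⟨ cong₂ _+_ (indicator-no (suc m ≤? 0) λ ()) shift ⟩
  count {n} (λ p → m ≤? toℕ p)
    ≡⟨ count-≥ n m ⟩
  n ∸ m
    ∎
  where
  open ≡-Reasoning
  shift : count {n} (λ p → suc m ≤? suc (toℕ p)) ≡ count {n} (λ p → m ≤? toℕ p)
  shift = count-cong {n} (λ p → suc m ≤? suc (toℕ p)) (λ p → m ≤? toℕ p) (λ _ → s≤s⁻¹) (λ _ → s≤s)

-- An injective endomap of Fin n is onto: otherwise, punching out a missed
-- value would inject Fin n into a set of size n − 1.
injective⇒surjective : ∀ {n} (g : Fin n → Fin n) → Injective _≡_ _≡_ g → ∀ p → ∃ λ i → g i ≡ p
injective⇒surjective {suc n} g g-inj p with any? (λ i → g i ≟ᶠ p)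
... | yes hit = hit
... | no miss = contradiction (injective⇒≤ squeezed-inj) 1+n≰n
  where
  avoids : ∀ i → p ≢ g i
  avoids i p≡gi = miss (i , sym p≡gi)
  squeezed : Fin (suc n) → Fin n
  squeezed i = punchOut (avoids i)
  squeezed-inj : Injective _≡_ _≡_ squeezed
  squeezed-inj eq = g-inj (punchOut-injective (avoids _) (avoids _) eq)

injective⇒permutation : ∀ {n} (g : Fin n → Fin n) → Injective _≡_ _≡_ g → Permutation′ n
injective⇒permutation {n} g g-inj =
  permutation g g⁻¹ (λ p → proj₂ (onto p)) (λ i → g-inj (proj₂ (onto (g i))))
  where
  onto : ∀ p → ∃ λ i → g i ≡ p
  onto = injective⇒surjective g g-inj
  g⁻¹ : Fin n → Fin n
  g⁻¹ p = proj₁ (onto p)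

rotation : ∀ m k → Permutation′ (m + k)
rotation m k =
  ↔-trans +↔⊎ (↔-trans (⊎-comm (Fin m) (Fin k)) (↔-trans (↔-sym +↔⊎) (cast-id (+-comm k m))))

rotation-shifts : ∀ m k p → m ≤ toℕ p → toℕ (rotation m k ⟨$⟩ʳ p) + m ≡ toℕ p
rotation-shifts m k p m≤p with splitAt m p in split
... | inj₁ j = contradiction m≤p (<⇒≱ (begin-strict
  toℕ p        ≡⟨ cong toℕ (splitAt⁻¹-↑ˡ split) ⟨
  toℕ (j ↑ˡ k) ≡⟨ toℕ-↑ˡ j k ⟩
  toℕ j        <⟨ toℕ<n j ⟩
  m            ∎))
  where open ≤-Reasoning
... | inj₂ j = begin
  toℕ (cast (+-comm k m) (j ↑ˡ m)) + m ≡⟨ cong (_+ m) (trans (toℕ-cast _ (j ↑ˡ m)) (toℕ-↑ˡ j m)) ⟩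
  toℕ j + m                            ≡⟨ +-comm (toℕ j) m ⟩
  m + toℕ j                            ≡⟨ toℕ-↑ʳ m j ⟨
  toℕ (m ↑ʳ j)                         ≡⟨ cong toℕ (splitAt⁻¹-↑ʳ split) ⟩
  toℕ p                                ∎
  where open ≡-Reasoning

shift-down : ∀ {n} m → m ≤ n →
  Σ (Permutation′ n) λ ρ → ∀ p → m ≤ toℕ p → toℕ (ρ ⟨$⟩ʳ p) + m ≡ toℕ p
shift-down m m≤n with m≤n⇒∃[o]m+o≡n m≤n
... | k , refl = rotation m k , rotation-shifts m k

module Ranking {n : ℕ} {c ℓ : Level} (S : StrictTotalOrder c ℓ 0ℓ)
  (key : Fin n → StrictTotalOrder.Carrier S)
  (key-injective : ∀ {i j} → StrictTotalOrder._≈_ S (key i) (key j) → i ≡ j) where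

  open StrictTotalOrder S using (compare; irrefl; module Eq)
    renaming (_<_ to _≺_; _<?_ to _≺?_; trans to ≺-trans)

  ≺-irrefl : ∀ i → ¬ key i ≺ key i
  ≺-irrefl i = irrefl Eq.refl

  rank : Fin n → ℕ
  rank i = count (λ j → key j ≺? key i)

  rank-mono : ∀ {i j} → key i ≺ key j → rank i < rank j
  rank-mono {i} {j} i≺j = count-strict (λ k → key k ≺? key i) (λ k → key k ≺? key j)
    (λ k k≺i → ≺-trans k≺i i≺j) i i≺j (≺-irrefl i)

  rank<n : ∀ i → rank i < n
  rank<n i = <-≤-trans
    (count-strict (λ k → key k ≺? key i) (λ _ → yes tt) (λ _ _ → tt) i tt (≺-irrefl i))
    (count-≤ {n} (λ (_ : Fin n) → yes tt))

  rank-injective : ∀ {i j} → rank i ≡ rank j → i ≡ j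
  rank-injective {i} {j} same with compare (key i) (key j)
  ... | tri< i≺j _ _ = contradiction same (<⇒≢ (rank-mono i≺j))
  ... | tri≈ _ i≈j _ = key-injective i≈j
  ... | tri> _ _ j≺i = contradiction (sym same) (<⇒≢ (rank-mono j≺i))

  rankFin : Fin n → Fin n
  rankFin i = fromℕ< (rank<n i)

  toℕ-rankFin : ∀ i → toℕ (rankFin i) ≡ rank i
  toℕ-rankFin i = toℕ-fromℕ< (rank<n i)

  ranking : Permutation′ n
  ranking = injective⇒permutation rankFin (λ {i} {j} same → rank-injective (begin
    rank i          ≡⟨ toℕ-rankFin i ⟨
    toℕ (rankFin i) ≡⟨ cong toℕ same ⟩
    toℕ (rankFin j) ≡⟨ toℕ-rankFin j ⟩
    rank j          ∎))
    where open ≡-Reasoning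

module Heights {n : ℕ} (f : Fin n → ℕ) where

  below level atMost above : ℕ → ℕ
  below  v = count (λ j → f j <? v)
  level  v = count (λ j → f j ≟ v)
  atMost v = count (λ j → f j ≤? v)
  above  v = count (λ j → v <? f j)

  descents : Permutation′ n → ℕ
  descents α = count (λ i → f (α ⟨$⟩ʳ i) <? f i)

  atMost-splits : ∀ v → atMost v ≤ below v + level v
  atMost-splits v = count-union (λ j → f j ≤? v) (λ j → f j <? v) (λ j → f j ≟ v)
    (λ j → m≤n⇒m<n∨m≡n)

  below-level-disjoint : ∀ v → below v + level v ≤ atMost v
  below-level-disjoint v = count-disjoint (λ j → f j <? v) (λ j → f j ≟ v) (λ j → f j ≤? v)
    (λ j fj<v fj≡v → <⇒≢ fj<v fj≡v) (λ j → [ <⇒≤ , ≤-reflexive ])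

  atMost-above-disjoint : ∀ v → atMost v + above v ≤ n
  atMost-above-disjoint v = ≤-trans
    (count-disjoint (λ j → f j ≤? v) (λ j → v <? f j) (λ _ → yes tt) (λ j → ≤⇒≯) (λ _ _ → tt))
    (count-≤ {n} (λ (_ : Fin n) → yes tt))

  -- Upper bound: each descent at i is above r at i or below r at α i, and
  -- α permutes the latter, so there are at most n ∸ level r descents.
  descents-bound : ∀ α r → descents α ≤ n ∸ level r
  descents-bound α r = m+n≤o⇒m≤o∸n (descents α) (begin
    descents α + level r               ≤⟨ +-monoˡ-≤ (level r) split ⟩
    above r + below r + level r        ≡⟨ +-assoc (above r) (below r) (level r) ⟩
    above r + (below r + level r)      ≤⟨ +-monoʳ-≤ (above r) (below-level-disjoint r) ⟩
    above r + atMost r                 ≡⟨ +-comm (above r) (atMost r) ⟩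
    atMost r + above r                 ≤⟨ atMost-above-disjoint r ⟩
    n                                  ∎)
    where
    open ≤-Reasoning
    through : ∀ {a b} → a < b → r < b ⊎ a < r
    through {a} {b} a<b with b ≤? r
    ... | yes b≤r = inj₂ (<-≤-trans a<b b≤r)
    ... | no  b≰r = inj₁ (≰⇒> b≰r)
    split : descents α ≤ above r + below r
    split = begin
      descents α                                 ≤⟨ count-union _ (λ i → r <? f i) lowerImage? (λ i → through) ⟩
      above r + count lowerImage?                ≡⟨ cong (above r +_) (count-permute (λ j → f j <? r) α) ⟩
      above r + below r                          ∎
      where
      lowerImage? : Decidable (λ i → f (α ⟨$⟩ʳ i) < r)
      lowerImage? i = f (α ⟨$⟩ʳ i) <? r

  heightOrder : StrictTotalOrder 0ℓ 0ℓ 0ℓ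
  heightOrder = ×-strictTotalOrder <-strictTotalOrder (<ᶠ-strictTotalOrder n)

  open StrictTotalOrder heightOrder using () renaming (_<?_ to _≺?_)
  open Ranking heightOrder (λ i → f i , i) proj₂

  below-≤-rank : ∀ i → below (f i) ≤ rank i
  below-≤-rank i = count-mono (λ j → f j <? f i) (λ j → (f j , j) ≺? (f i , i)) (λ j → inj₁)

  rank-<-level : ∀ i → rank i < below (f i) + level (f i)
  rank-<-level i = <-≤-trans
    (count-strict (λ j → (f j , j) ≺? (f i , i)) (λ j → f j ≤? f i)
      (λ j → [ <⇒≤ , ≤-reflexive ∘ proj₁ ]) i ≤-refl (≺-irrefl i))
    (atMost-splits (f i))

  below-mono : ∀ {a b} → a ≤ b → below a ≤ below b
  below-mono {a} {b} a≤b =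
    count-mono (λ j → f j <? a) (λ j → f j <? b) (λ j fj<a → <-≤-trans fj<a a≤b)

  lower-by-rank : ∀ {m} → (∀ v → level v ≤ m) → ∀ {i j} → rank j + m ≡ rank i → f j < f i
  lower-by-rank {m} levels≤m {i} {j} shifted with f j <? f i
  ... | yes fj<fi = fj<fi
  ... | no  fj≮fi = contradiction shifted (<⇒≢ (begin-strict
    rank i                      <⟨ rank-<-level i ⟩
    below (f i) + level (f i)   ≤⟨ +-monoʳ-≤ (below (f i)) (levels≤m (f i)) ⟩
    below (f i) + m             ≤⟨ +-monoˡ-≤ m (below-mono (≮⇒≥ fj≮fi)) ⟩
    below (f j) + m             ≤⟨ +-monoˡ-≤ m (below-≤-rank j) ⟩
    rank j + m                  ∎) ∘ sym)
    where open ≤-Reasoning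

  -- Lower bound: if no level exceeds m ≤ n, sending each element to the one
  -- m ranks below it (cyclically) descends at every rank ≥ m.
  descents-attained : ∀ m → (∀ v → level v ≤ m) → m ≤ n →
    Σ (Permutation′ n) λ α → n ∸ m ≤ descents α
  descents-attained m levels≤m m≤n = α , (begin
    n ∸ m                                   ≡⟨ count-≥ n m ⟨
    count {n} (λ p → m ≤? toℕ p)             ≡⟨ count-permute (λ p → m ≤? toℕ p) ranking ⟨
    count (λ i → m ≤? toℕ (ranking ⟨$⟩ʳ i))  ≤⟨ count-mono _ (λ i → f (α ⟨$⟩ʳ i) <? f i) high⇒descent ⟩
    descents α                              ∎)
    where
    open ≤-Reasoning
    ρ : Permutation′ n
    ρ = proj₁ (shift-down m m≤n)
    α : Permutation′ n
    α = ranking ∘ₚ ρ ∘ₚ flip ranking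
    rank-α : ∀ i → m ≤ toℕ (ranking ⟨$⟩ʳ i) → rank (α ⟨$⟩ʳ i) + m ≡ rank i
    rank-α i m≤p = begin-equality
      rank (α ⟨$⟩ʳ i) + m                    ≡⟨ cong (_+ m) (toℕ-rankFin (α ⟨$⟩ʳ i)) ⟨
      toℕ (ranking ⟨$⟩ʳ (α ⟨$⟩ʳ i)) + m       ≡⟨ cong (λ p → toℕ p + m) (inverseʳ ranking) ⟩
      toℕ (ρ ⟨$⟩ʳ (ranking ⟨$⟩ʳ i)) + m       ≡⟨ proj₂ (shift-down m m≤n) (ranking ⟨$⟩ʳ i) m≤p ⟩
      toℕ (ranking ⟨$⟩ʳ i)                   ≡⟨ toℕ-rankFin i ⟩
      rank i                                ∎
    high⇒descent : ∀ i → m ≤ toℕ (ranking ⟨$⟩ʳ i) → f (α ⟨$⟩ʳ i) < f i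
    high⇒descent i m≤p = lower-by-rank levels≤m (rank-α i m≤p)

  maximal-descents : ∀ r → (∀ v → level v ≤ level r) →
    ((α : Permutation′ n) → descents α ≤ n ∸ level r)
      × Σ (Permutation′ n) (λ α → descents α ≡ n ∸ level r)
  maximal-descents r maximal =
    (λ α → descents-bound α r) , (α , ≤-antisym (descents-bound α r) attained)
    where
    witness : Σ (Permutation′ n) λ α → n ∸ level r ≤ descents α
    witness = descents-attained (level r) maximal (count-≤ (λ j → f j ≟ r))
    α : Permutation′ n
    α = proj₁ witness
    attained : n ∸ level r ≤ descents α
    attained = proj₂ witness

mainTheorem12 : (n : ℕ) (π : Partition n) (r : ℕ) →
    ((k : ℕ) → zoneSize π k ≤ zoneSize π r) →
    ((α : Permutation′ n) → descentCount π α ≤ n ∸ zoneSize π r)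
      × Σ (Permutation′ n) (λ α → descentCount π α ≡ n ∸ zoneSize π r)
mainTheorem12 n π r maximal = bounded , (α , equal)
  where
  open Heights (blockSize π)
  zone≡ : ∀ k → zoneSize π k ≡ level k
  zone≡ k = count-filter (λ i → blockSize π i ≟ k) (λ i → i)
  descents≡ : ∀ α → descentCount π α ≡ descents α
  descents≡ α = count-filter (λ i → blockSize π (α ⟨$⟩ʳ i) <? blockSize π i) (λ i → i)
  result : ((α : Permutation′ n) → descents α ≤ n ∸ level r)
         × Σ (Permutation′ n) (λ α → descents α ≡ n ∸ level r)
  result = maximal-descents r (λ v → subst₂ _≤_ (zone≡ v) (zone≡ r) (maximal v))
  bounded : (α : Permutation′ n) → descentCount π α ≤ n ∸ zoneSize π r
  bounded α = subst₂ (λ d z → d ≤ n ∸ z) (sym (descents≡ α)) (sym (zone≡ r)) (proj₁ result α)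
  α : Permutation′ n
  α = proj₁ (proj₂ result)
  equal : descentCount π α ≡ n ∸ zoneSize π r
  equal = subst₂ (λ d z → d ≡ n ∸ z) (sym (descents≡ α)) (sym (zone≡ r)) (proj₂ (proj₂ result))
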